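{- Let $\mathcal{CP}$ be a non-extensible combinatorial torus cube packing in dimension $n$ and let $p=(C_1,\dots,C_m)$ be a positive path for $\mathcal{CP}$. Then: (i) $N_{n,p}(\mathcal{CP})=1$ and $N_{n-1,p}(\mathcal{CP})=1$; (ii) $N_{n-2,p}(\mathcal{CP})\leq 2$, and $N_{n-2,p}(\mathcal{CP})=2$ if and only if $\mathcal{CP}$ is laminated; (iii) $N_{k,p}(\mathcal{CP})\geq1$ for $0\leq k\leq n$; (iv) $N(\mathcal{CP})=\sum_{k=0}^n k\,N_{k,p}(\mathcal{CP})\geq\frac{n(n+1)}{2}$; (v) if $N(\mathcal{CP})=\frac{n(n+1)}2$ then $N_{k,p}(\mathcal{CP})=1$ for all $k\geq1$.
   Context: A combinatorial torus cube in dimension $n$ is a formal cube $z+[0,1]^n$, $z=(z_1,\dots,z_n)$, with each $z_j$ equal to $t$ or $t+1$ for a formal parameter $t$, parameters in different coordinates being distinct. Two such cubes are non-overlapping if for some coordinate $j$, $z_j,z'_j$ involve the same parameter $t$ and $\{z_j,z'_j\}=\{t,t+1\}$. A combinatorial torus cube packing is a finite family of pairwise non-overlapping such cubes; $N(\mathcal{CP})$ is its number of distinct parameters. It is non-extensible if it has fewer than $2^n$ cubes and no combinatorial torus cube (using old or new parameters) can be added keeping non-overlap. It is laminated if there are a coordinate $j$ and a parameter $t$ with $z_j\in\{t,t+1\}$ for every cube $z+[0,1]^n$ of it. A path for $\mathcal{CP}$ is an ordering $C_1,\dots,C_m$ of its cubes (the order in which the cubes are added in the sequential random packing process). For each $i$,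 the number of new parameters of $C_i$ is the number of parameters of $C_i$ not occurring in $C_1,\dots,C_{i-1}$. The path is positive (i.e. it has strictly positive limiting probability as $N\to\infty$ in the sequential random discrete torus cube packing process) iff for every $i$ the number of new parameters of $C_i$ is maximal among the numbers of new parameters (relative to $C_1,\dots,C_{i-1}$) of all combinatorial torus cubes not overlapping $C_1,\dots,C_{i-1}$. $N_{k,p}(\mathcal{CP})$ is the number of indices $i$ such that $C_i$ has exactly $k$ new parameters. -}

module Defs where

open import Data.Nat using (ℕ; zero; suc; _+_; _*_; _∸_; _^_; _≤_; _<_)
open import Data.Nat.Properties using () renaming (_≟_ to _≟ℕ_)
open import Data.Bool using (Bool; true; false; if_then_else_)
open import Data.Fin using (Fin)
open import Data.Fin.Properties using () renaming (_≟_ to _≟F_)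
open import Data.Product using (Σ; ∃; _×_; _,_; proj₁; proj₂)
open import Data.Product.Properties using (≡-dec)
open import Data.List using (List; []; _∷_; _++_; [_]; length; filter; map; concatMap; deduplicate; allFin)
open import Data.List.Relation.Unary.All using (All; all?)
open import Data.List.Relation.Unary.AllPairs using (AllPairs)
open import Data.List.Membership.Propositional using (_∈_)
open import Data.List.Relation.Binary.Permutation.Propositional using (_↭_)
open import Relation.Binary.PropositionalEquality using (_≡_; _≢_)
open import Relation.Nullary using (¬_; ¬?)
open import Relation.Nullary.Decidable using (⌊_⌋)

-- A combinatorial torus cube z + [0,1]^n.  Coordinate j carries the pair
-- (label , b): its parameter is the pair (j , label) (so parameters in
-- different coordinates are automatically distinct) and z_j = t if b = false,
-- z_j = t + 1 if b = true.
Cube : ℕ → Set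
Cube n = Fin n → ℕ × Bool

label : ∀ {n} → Cube n → Fin n → ℕ
label c j = proj₁ (c j)

shift : ∀ {n} → Cube n → Fin n → Bool
shift c j = proj₂ (c j)

NonOverlap : ∀ {n} → Cube n → Cube n → Set
NonOverlap {n} c d = Σ (Fin n) λ j → (label c j ≡ label d j) × (shift c j ≢ shift d j)

IsPacking : ∀ {n} → List (Cube n) → Set
IsPacking cp = AllPairs NonOverlap cp

NonExtensible : ∀ {n} → List (Cube n) → Set
NonExtensible {n} cp =
  (length cp < 2 ^ n) × (∀ (d : Cube n) → ¬ All (NonOverlap d) cp)

Laminated : ∀ {n} → List (Cube n) → Set
Laminated {n} cp = Σ (Fin n) λ j → Σ ℕ λ t → All (λ c → label c j ≡ t) cp

params : ∀ {n} → List (Cube n) → List (Fin n × ℕ)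
params {n} cp = concatMap (λ c → map (λ j → (j , label c j)) (allFin n)) cp

numParams : ∀ {n} → List (Cube n) → ℕ
numParams cp = length (deduplicate (≡-dec _≟F_ _≟ℕ_) (params cp))

newParams : ∀ {n} → List (Cube n) → Cube n → ℕ
newParams {n} pre c =
  length (filter (λ j → all? (λ d → ¬? (label d j ≟ℕ label c j)) pre) (allFin n))

PositivePath : ∀ {n} → List (Cube n) → Set
PositivePath {n} p =
  ∀ (pre : List (Cube n)) (c : Cube n) (post : List (Cube n)) →
  p ≡ pre ++ c ∷ post →
  ∀ (d : Cube n) → All (NonOverlap d) pre → newParams pre d ≤ newParams pre c

NkGo : ∀ {n} → ℕ → List (Cube n) → List (Cube n) → ℕ
NkGo k acc [] = 0
NkGo k acc (c ∷ rest) =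
  (if ⌊ newParams acc c ≟ℕ k ⌋ then 1 else 0) + NkGo k (acc ++ [ c ]) rest

Nk : ∀ {n} → ℕ → List (Cube n) → ℕ
Nk k p = NkGo k [] p

sumTo : ℕ → (ℕ → ℕ) → ℕ
sumTo zero f = f 0
sumTo (suc n) f = sumTo n f + f (suc n)

module Submission where

-- Let v(pre, X) be the number of new parameters of X placed after the cubes pre.  On a
-- positive path every cube is good: admissible after its predecessors and of maximal v
-- among admissible cubes.  Everything follows from one comparison principle
-- (good-exchange): an admissible competitor that gains |ks| fresh coordinates and loses at
-- most |js| shows |ks| ≤ |js|.  From it:
--   * along the path v never increases, drops by at most one per step (reflect the last
--     cube at a fresh coordinate), and is 0 at the end (otherwise the reflected cube could
--     be added), so every value 0..n occurs: part (iii);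
--   * C₁, C₂, C₃ have n, n-1, n-2 new parameters, and C₁, C₂ meet at a coordinate j₀,
--     spanning a layer.  If C₃ leaves the layer, all later cubes have v ≤ n-3 and no
--     coordinate is common to all cubes; if C₃ stays, C₄ completes the layer with v = n-2,
--     all later cubes have v ≤ n-3 and stay in the layer: parts (i) and (ii);
--   * N(CP) is the sum of the v's, i.e. Σ k·N_k, and N_k ≥ 1 gives (iv) and (v).

open import Data.Nat using (ℕ; _+_; _*_; _∸_; _≤_; _/_)
open import Data.Product using (_×_)
open import Data.List using (List)
open import Data.List.Relation.Binary.Permutation.Propositional using (_↭_)
open import Function.Bundles using (_⇔_)
open import Relation.Binary.PropositionalEquality using (_≡_)

open import Defs
open import Level using (0ℓ)
open import Algebra.Properties.CommutativeSemigroup using (interchange)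
open import Data.Bool using (Bool; false; if_then_else_; not)
open import Data.Bool.Properties using (not-¬; ¬-not) renaming (_≟_ to _≟B_)
open import Data.Fin using (Fin; punchIn) renaming (zero to fzero; suc to fsuc)
open import Data.Fin.Properties using (punchInᵢ≢i) renaming (_≟_ to _≟F_; suc-injective to fsuc-injective)
open import Data.List using ([]; _∷_; _++_; [_]; length; filter; map; tabulate; allFin; deduplicate)
open import Data.List.Membership.Propositional using (_∈_; _∉_)
open import Data.List.Membership.Propositional.Properties
  using (∈-++⁺ˡ; ∈-++⁺ʳ; ∈-++⁻; ∈-∃++; ∈-filter⁺; ∈-filter⁻; ∈-deduplicate⁺; ∈-deduplicate⁻;
         ∈-map⁺; ∈-map⁻; ∈-allFin; ∈-concatMap⁺; ∈-concatMap⁻)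
open import Data.List.Properties using (++-assoc; ++-identityʳ; length-++; length-++-sucʳ; concatMap-++)
open import Data.List.Relation.Binary.Permutation.Propositional using (↭-sym; ↭⇒↭ₛ)
open import Data.List.Relation.Binary.Permutation.Propositional.Properties using (All-resp-↭; Any-resp-↭; ↭-length)
import Data.List.Relation.Binary.Permutation.Setoid.Properties as PermProps
open import Data.List.Relation.Binary.Subset.Propositional using (_⊆_)
open import Data.List.Relation.Unary.All using (All; []; _∷_; all?)
import Data.List.Relation.Unary.All as All
open import Data.List.Relation.Unary.All.Properties using (++⁺; ++⁻ˡ; All¬⇒¬Any)
open import Data.List.Relation.Unary.AllPairs using ([]; _∷_)
open import Data.List.Relation.Unary.Any using (here; there)
import Data.List.Relation.Unary.Any as Any
open import Data.List.Relation.Unary.Unique.DecPropositional.Properties using (deduplicate-!)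
open import Data.List.Relation.Unary.Unique.Propositional using (Unique)
import Data.List.Relation.Unary.Unique.Propositional.Properties as UP
open import Data.Nat using (zero; suc; _<_; _^_; z≤n; s≤s; _≤?_)
open import Data.Nat.DivMod using (m*n/n≡m)
open import Data.Nat.Properties renaming (_≟_ to _≟ℕ_)
open import Data.Nat.Tactic.RingSolver using (solve-∀)
open import Data.Product using (Σ; ∃; _,_; proj₁; proj₂; map₂)
open import Data.Product.Properties using (≡-dec)
open import Data.Sum using (_⊎_; inj₁; inj₂) renaming ([_,_] to either)
open import Data.Unit using (tt)
open import Data.Vec.Functional using (updateAt)
open import Data.Vec.Functional.Properties using (updateAt-updates; updateAt-minimal)
open import Function.Base using (_∘_; _$_; id; const)
open import Function.Bundles using (mk⇔; module Equivalence)
open Equivalence using (to; from)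
open import Relation.Binary.Definitions using (DecidableEquality)
open import Relation.Binary.PropositionalEquality
  using (_≢_; refl; sym; trans; cong; cong₂; subst; setoid; resp₂; module ≡-Reasoning)
open import Relation.Nullary using (¬_; ¬?; Dec; yes; no; does; contradiction)
open import Relation.Nullary.Decidable using (⌊_⌋; _⊎-dec_; map′)
open import Relation.Unary using (Pred; Decidable)

count : ∀ {n} {P : Pred (Fin n) 0ℓ} → Decidable P → ℕ
count {zero}  P? = 0
count {suc n} P? = (if does (P? fzero) then 1 else 0) + count (P? ∘ fsuc)

count-mono : ∀ {n} {P Q : Pred (Fin n) 0ℓ} (P? : Decidable P) (Q? : Decidable Q) →
  (∀ j → P j → Q j) → count P? ≤ count Q?
count-mono {zero}  P? Q? P⊆Q = z≤n
count-mono {suc n} P? Q? P⊆Q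
  with ih ← count-mono (P? ∘ fsuc) (Q? ∘ fsuc) (P⊆Q ∘ fsuc) | P? fzero | Q? fzero
... | yes p | no ¬q = contradiction (P⊆Q fzero p) ¬q
... | yes _ | yes _ = s≤s ih
... | no _  | yes _ = m≤n⇒m≤1+n ih
... | no _  | no _  = ih

count-insert : ∀ {n} {P Q : Pred (Fin n) 0ℓ} (P? : Decidable P) (Q? : Decidable Q) →
  (∀ j → P j → Q j) → (k : Fin n) → ¬ P k → Q k → suc (count P?) ≤ count Q?
count-insert P? Q? P⊆Q fzero ¬Pk Qk
  with ih ← count-mono (P? ∘ fsuc) (Q? ∘ fsuc) (P⊆Q ∘ fsuc) | P? fzero | Q? fzero
... | yes p | _     = contradiction p ¬Pk
... | no _  | no ¬q = contradiction Qk ¬q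
... | no _  | yes _ = s≤s ih
count-insert P? Q? P⊆Q (fsuc k) ¬Pk Qk
  with ih ← count-insert (P? ∘ fsuc) (Q? ∘ fsuc) (P⊆Q ∘ fsuc) k ¬Pk Qk | P? fzero | Q? fzero
... | yes p | no ¬q = contradiction (P⊆Q fzero p) ¬q
... | yes _ | yes _ = s≤s ih
... | no _  | yes _ = m≤n⇒m≤1+n ih
... | no _  | no _  = ih

count-remove : ∀ {n} {P Q : Pred (Fin n) 0ℓ} (P? : Decidable P) (Q? : Decidable Q) →
  (k : Fin n) → (∀ j → j ≢ k → P j → Q j) → count P? ≤ suc (count Q?)
count-remove P? Q? fzero P⊆Q
  with ih ← count-mono (P? ∘ fsuc) (Q? ∘ fsuc) (λ j → P⊆Q (fsuc j) λ ()) | P? fzero | Q? fzero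
... | yes _ | yes _ = s≤s (m≤n⇒m≤1+n ih)
... | yes _ | no _  = s≤s ih
... | no _  | yes _ = m≤n⇒m≤1+n (m≤n⇒m≤1+n ih)
... | no _  | no _  = m≤n⇒m≤1+n ih
count-remove P? Q? (fsuc k) P⊆Q
  with ih ← count-remove (P? ∘ fsuc) (Q? ∘ fsuc) k (λ j j≢k → P⊆Q (fsuc j) (j≢k ∘ fsuc-injective))
     | P? fzero | Q? fzero
... | yes p | no ¬q = contradiction (P⊆Q fzero (λ ()) p) ¬q
... | yes _ | yes _ = s≤s ih
... | no _  | yes _ = m≤n⇒m≤1+n ih
... | no _  | no _  = ih

count-cong : ∀ {n} {P Q : Pred (Fin n) 0ℓ} (P? : Decidable P) (Q? : Decidable Q) →
  (∀ j → P j → Q j) → (∀ j → Q j → P j) → count P? ≡ count Q?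
count-cong P? Q? P⊆Q Q⊆P = ≤-antisym (count-mono P? Q? P⊆Q) (count-mono Q? P? Q⊆P)

count-all : ∀ {n} {P : Pred (Fin n) 0ℓ} (P? : Decidable P) → (∀ j → P j) → count P? ≡ n
count-all {zero}  P? all = refl
count-all {suc n} P? all with P? fzero
... | yes _ = cong suc (count-all (P? ∘ fsuc) (all ∘ fsuc))
... | no ¬p = contradiction (all fzero) ¬p

count-≤ : ∀ {n} {P : Pred (Fin n) 0ℓ} (P? : Decidable P) → count P? ≤ n
count-≤ {n} P? = ≤-trans (count-mono P? (λ _ → yes tt) (λ _ _ → tt)) (≤-reflexive (count-all _ (λ _ → tt)))

count-witness : ∀ {n} {P : Pred (Fin n) 0ℓ} (P? : Decidable P) → 1 ≤ count P? → ∃ P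
count-witness {suc n} P? pos with P? fzero
... | yes p = fzero , p
... | no _  = let (j , p) = count-witness (P? ∘ fsuc) pos in fsuc j , p

count-exchange : ∀ {n} {P Q : Pred (Fin n) 0ℓ} (P? : Decidable P) (Q? : Decidable Q) →
  (js ks : List (Fin n)) → (∀ j → j ∉ js → P j → Q j) → Unique ks →
  All (λ k → ¬ P k × Q k) ks → length ks + count P? ≤ length js + count Q?
count-exchange P? Q? [] [] P⊆Q _ _ = count-mono P? Q? (λ j → P⊆Q j λ ())
count-exchange {P = P} {Q} P? Q? [] (k ∷ ks) P⊆Q (k∉ks ∷ unique) ((¬Pk , Qk) ∷ gains) = begin
  suc (length ks + count P?)  ≡⟨ sym (+-suc (length ks) _) ⟩
  length ks + suc (count P?)  ≤⟨ +-monoʳ-≤ (length ks) (count-insert P? P∪k? (λ _ → inj₁) k ¬Pk (inj₂ refl)) ⟩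
  length ks + count P∪k?      ≤⟨ count-exchange P∪k? Q? [] ks P∪k⊆Q unique gains′ ⟩
  count Q?                    ∎
  where
  open ≤-Reasoning
  P∪k? : Decidable (λ j → P j ⊎ j ≡ k)
  P∪k? j = P? j ⊎-dec (j ≟F k)
  P∪k⊆Q : ∀ j → j ∉ [] → P j ⊎ j ≡ k → Q j
  P∪k⊆Q j _ (inj₁ Pj)  = P⊆Q j (λ ()) Pj
  P∪k⊆Q j _ (inj₂ refl) = Qk
  gains′ : All (λ j → ¬ (P j ⊎ j ≡ k) × Q j) ks
  gains′ = All.zipWith (λ { (k≢j , ¬Pj , Qj) → either ¬Pj (k≢j ∘ sym) , Qj }) (k∉ks , gains)
count-exchange {P = P} {Q} P? Q? (j ∷ js) ks P⊆Q unique gains = begin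
  length ks + count P?        ≤⟨ count-exchange P? Q∪j? js ks P⊆Q∪j unique (All.map (map₂ inj₁) gains) ⟩
  length js + count Q∪j?      ≤⟨ +-monoʳ-≤ (length js) (count-remove Q∪j? Q? j Q∪j⊆Q) ⟩
  length js + suc (count Q?)  ≡⟨ +-suc (length js) _ ⟩
  suc (length js) + count Q?  ∎
  where
  open ≤-Reasoning
  Q∪j? : Decidable (λ i → Q i ⊎ i ≡ j)
  Q∪j? i = Q? i ⊎-dec (i ≟F j)
  P⊆Q∪j : ∀ i → i ∉ js → P i → Q i ⊎ i ≡ j
  P⊆Q∪j i i∉js Pi with i ≟F j
  ... | yes i≡j = inj₂ i≡j
  ... | no i≢j  = inj₁ (P⊆Q i (λ { (here i≡j) → i≢j i≡j ; (there i∈js) → i∉js i∈js }) Pi)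
  Q∪j⊆Q : ∀ i → i ≢ j → Q i ⊎ i ≡ j → Q i
  Q∪j⊆Q i _   (inj₁ Qi)  = Qi
  Q∪j⊆Q i i≢j (inj₂ i≡j) = contradiction i≡j i≢j

length-filter-tabulate : ∀ {n} {A : Set} {P : Pred A 0ℓ} (P? : Decidable P) (f : Fin n → A) →
  length (filter P? (tabulate f)) ≡ count (P? ∘ f)
length-filter-tabulate {zero}  P? f = refl
length-filter-tabulate {suc n} P? f with P? (f fzero)
... | yes _ = cong suc (length-filter-tabulate P? (f ∘ fsuc))
... | no _  = length-filter-tabulate P? (f ∘ fsuc)

two-sides : ∀ {x b b′ : Bool} → x ≢ b → x ≢ b′ → b ≡ b′
two-sides x≢b x≢b′ = trans (¬-not (x≢b ∘ sym)) (sym (¬-not (x≢b′ ∘ sym)))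

module _ {n : ℕ} where

  record Fresh (pre : List (Cube n)) (c : Cube n) (j : Fin n) : Set where
    constructor mk-fresh
    field distinct-from : All (λ d → label d j ≢ label c j) pre
  open Fresh public

  fresh? : (pre : List (Cube n)) (c : Cube n) → Decidable (Fresh pre c)
  fresh? pre c j = map′ mk-fresh distinct-from (all? (λ d → ¬? (label d j ≟ℕ label c j)) pre)

  newParams≡count : (pre : List (Cube n)) (c : Cube n) → newParams pre c ≡ count (fresh? pre c)
  newParams≡count pre c = trans (length-filter-tabulate unused? id)
                                 (count-cong unused? (fresh? pre c) (λ _ → mk-fresh) (λ _ → distinct-from))
    where
    unused? : Decidable (λ j → All (λ d → label d j ≢ label c j) pre)
    unused? j = all? (λ d → ¬? (label d j ≟ℕ label c j)) pre

  newParams-exchange : ∀ {pre pre′ : List (Cube n)} {X Y : Cube n} (js ks : List (Fin n)) →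
    (∀ j → j ∉ js → Fresh pre X j → Fresh pre′ Y j) → Unique ks →
    All (λ k → ¬ Fresh pre X k × Fresh pre′ Y k) ks →
    length ks + newParams pre X ≤ length js + newParams pre′ Y
  newParams-exchange {pre} {pre′} {X} {Y} js ks sub unique gains
    rewrite newParams≡count pre X | newParams≡count pre′ Y =
    count-exchange (fresh? pre X) (fresh? pre′ Y) js ks sub unique gains

  newParams-≤ : (pre : List (Cube n)) (X : Cube n) → newParams pre X ≤ n
  newParams-≤ pre X rewrite newParams≡count pre X = count-≤ (fresh? pre X)

  newParams-[] : (X : Cube n) → newParams [] X ≡ n
  newParams-[] X rewrite newParams≡count [] X = count-all (fresh? [] X) (λ _ → mk-fresh [])

  newParams-stale : ∀ {pre X} (ks : List (Fin n)) → Unique ks →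
    All (λ k → ¬ Fresh pre X k) ks → length ks + newParams pre X ≤ n
  newParams-stale {pre} {X} ks unique stale rewrite newParams≡count pre X =
    ≤-trans (count-exchange (fresh? pre X) (λ _ → yes tt) [] ks (λ _ _ _ → tt) unique
                            (All.map (_, tt) stale))
            (≤-reflexive (count-all _ (λ _ → tt)))

  newParams-cover : ∀ {pre X} (js : List (Fin n)) → (∀ j → j ∉ js → Fresh pre X j) →
    n ≤ length js + newParams pre X
  newParams-cover {pre} {X} js fresh rewrite newParams≡count pre X =
    ≤-trans (≤-reflexive (sym (count-all (λ _ → yes tt) (λ _ → tt))))
            (count-exchange (λ _ → yes tt) (fresh? pre X) js [] (λ j j∉js _ → fresh j j∉js) [] [])

  fresh-witness : ∀ pre X → 1 ≤ newParams pre X → ∃ (Fresh pre X)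
  fresh-witness pre X pos = count-witness (fresh? pre X) (subst (1 ≤_) (newParams≡count pre X) pos)

  newParams-antitone : ∀ pre more X → newParams (pre ++ more) X ≤ newParams pre X
  newParams-antitone pre more X rewrite newParams≡count (pre ++ more) X | newParams≡count pre X =
    count-mono (fresh? (pre ++ more) X) (fresh? pre X) (λ _ → mk-fresh ∘ ++⁻ˡ pre ∘ distinct-from)

  record Separated (X d : Cube n) (k : Fin n) : Set where
    constructor mk-sep
    field
      same-label    : label X k ≡ label d k
      opposite-side : shift X k ≢ shift d k
  open Separated public

  separation : ∀ {X d} → NonOverlap X d → ∃ (Separated X d)
  separation (k , same , opposite) = k , mk-sep same opposite

  nonOverlap : ∀ {X d} → ∃ (Separated X d) → NonOverlap X d
  nonOverlap (k , mk-sep same opposite) = k , same , opposite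

  nonOverlap-sym : ∀ {c d : Cube n} → NonOverlap c d → NonOverlap d c
  nonOverlap-sym (k , same , side) = k , sym same , side ∘ sym

  ApartAt : Cube n → Cube n → Fin n → Set
  ApartAt d e k = label d k ≡ label e k → shift d k ≢ shift e k

  separated-stale : ∀ {pre X d k} → d ∈ pre → Separated X d k → ¬ Fresh pre X k
  separated-stale d∈ sep f = All.lookup (distinct-from f) d∈ (sym (same-label sep))

  distinct₂ : ∀ {i j : Fin n} → i ≢ j → Unique (i ∷ j ∷ [])
  distinct₂ i≢j = (i≢j ∷ []) ∷ [] ∷ []

  distinct₃ : ∀ {i j k : Fin n} → i ≢ j → i ≢ k → j ≢ k → Unique (i ∷ j ∷ k ∷ [])
  distinct₃ i≢j i≢k j≢k = (i≢j ∷ i≢k ∷ []) ∷ (j≢k ∷ []) ∷ [] ∷ []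

  separation-coords-differ : ∀ {X d e k l} → Separated X d k → Separated X e l → ApartAt d e k → k ≢ l
  separation-coords-differ (mk-sep same-d side-d) (mk-sep same-e side-e) apart refl =
    apart (trans (sym same-d) same-e) (two-sides side-d side-e)

  separated-agree : ∀ {d k} (X Y : Cube n) → Y k ≡ X k → Separated X d k → Separated Y d k
  separated-agree X Y Yk≡Xk (mk-sep same side) =
    mk-sep (trans (cong proj₁ Yk≡Xk) same) (side ∘ trans (cong proj₂ (sym Yk≡Xk)))

  fresh-agree : ∀ {pre k} (X Y : Cube n) → Y k ≡ X k → Fresh pre X k → Fresh pre Y k
  fresh-agree {pre} {k} X Y Yk≡Xk =
    mk-fresh ∘ subst (λ v → All (λ d → label d k ≢ v) pre) (cong proj₁ (sym Yk≡Xk)) ∘ distinct-from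

  freshLabel : List (Cube n) → Fin n → ℕ
  freshLabel []        j = 0
  freshLabel (d ∷ pre) j = suc (label d j + freshLabel pre j)

  freshCube : List (Cube n) → Cube n
  freshCube pre j = (freshLabel pre j , false)

  freshLabel-exceeds : ∀ {pre d} (j : Fin n) → d ∈ pre → label d j < freshLabel pre j
  freshLabel-exceeds {e ∷ pre} j (here refl)  = s≤s (m≤m+n _ _)
  freshLabel-exceeds {e ∷ pre} j (there d∈)   = m<n⇒m<1+n (≤-trans (freshLabel-exceeds j d∈) (m≤n+m _ _))

  freshLabel-fresh : ∀ {pre c} (j : Fin n) → label c j ≡ freshLabel pre j → Fresh pre c j
  freshLabel-fresh j c≡fresh =
    mk-fresh $ All.tabulate λ d∈ d≡c → <-irrefl (trans d≡c c≡fresh) (freshLabel-exceeds j d∈)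

  _[_]≔_ : Cube n → Fin n → ℕ × Bool → Cube n
  X [ j ]≔ v = updateAt X j (const v)

  ≔-here : ∀ X j v → (X [ j ]≔ v) j ≡ v
  ≔-here X j v = updateAt-updates j X

  ≔-there : ∀ X j v {k} → k ≢ j → (X [ j ]≔ v) k ≡ X k
  ≔-there X j v {k} k≢j = updateAt-minimal k j X k≢j

  Admissible : List (Cube n) → Cube n → Set
  Admissible pre d = All (λ e → ∃ (Separated d e)) pre

  Saturated : List (Cube n) → Set
  Saturated pre = ∀ d → ¬ Admissible pre d

  Good : List (Cube n) → Cube n → Set
  Good pre c = Admissible pre c × (∀ d → Admissible pre d → newParams pre d ≤ newParams pre c)

  data Walk (acc : List (Cube n)) : List (Cube n) → Set where
    []  : Walk acc []
    _∷_ : ∀ {c r} → Good acc c → Walk (acc ++ [ c ]) r → Walk acc (c ∷ r)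

  admissible-before : ∀ acc c r → IsPacking (acc ++ c ∷ r) → Admissible acc c
  admissible-before []        c r _                = []
  admissible-before (x ∷ acc) c r (x-rest ∷ pack) =
    separation (nonOverlap-sym (All.lookup x-rest (∈-++⁺ʳ acc (here refl)))) ∷ admissible-before acc c r pack

  positive-walk : ∀ acc r → IsPacking (acc ++ r) → PositivePath (acc ++ r) → Walk acc r
  positive-walk acc []      _    _   = []
  positive-walk acc (c ∷ r) pack pos =
    (admissible-before acc c r pack , λ d adm → pos acc c r refl d (All.map nonOverlap adm)) ∷
    positive-walk (acc ++ [ c ]) r (subst IsPacking reassoc pack) (subst PositivePath reassoc pos)
    where
    reassoc : acc ++ c ∷ r ≡ (acc ++ [ c ]) ++ r
    reassoc = sym (++-assoc acc [ c ] r)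

  good-exchange : ∀ {pre X Y} → Good pre X → Admissible pre Y → (js ks : List (Fin n)) →
    (∀ j → j ∉ js → Fresh pre X j → Fresh pre Y j) → Unique ks →
    All (λ k → ¬ Fresh pre X k × Fresh pre Y k) ks → length ks ≤ length js
  good-exchange {pre} {X} {Y} (_ , maximal) admY js ks sub unique gains =
    +-cancelʳ-≤ (newParams pre X) (length ks) (length js)
      (≤-trans (newParams-exchange {pre} {pre} {X} {Y} js ks sub unique gains)
               (+-monoʳ-≤ (length js) (maximal Y admY)))

  good-fresh : ∀ {pre X} → Good pre X → (j : Fin n) →
    (∀ {d} → d ∈ pre → Σ (Fin n) λ k → k ≢ j × Separated X d k) → Fresh pre X j
  good-fresh {pre} {X} good j separated-elsewhere with fresh? pre X j
  ... | yes fresh = fresh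
  ... | no stale  = contradiction
        (good-exchange good admY [] (j ∷ []) keeps ([] ∷ []) ((stale , freshY) ∷ [])) λ ()
    where
    Y : Cube n
    Y = X [ j ]≔ freshCube pre j
    freshY : Fresh pre Y j
    freshY = freshLabel-fresh {c = Y} j (cong proj₁ (≔-here X j _))
    admY : Admissible pre Y
    admY = All.tabulate λ {d} d∈ → let (k , k≢j , sep) = separated-elsewhere d∈
                                   in k , separated-agree {d} X Y (≔-there X j _ k≢j) sep
    keeps : ∀ k → k ∉ [] → Fresh pre X k → Fresh pre Y k
    keeps k _ fresh with k ≟F j
    ... | yes refl = freshY
    ... | no k≢j   = fresh-agree X Y (≔-there X j _ k≢j) fresh

  module Successor (pre : List (Cube n)) (c : Cube n) (j* : Fin n) where
    successor : Cube n
    successor k with k ≟F j* | fresh? pre c k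
    ... | yes _ | _     = (label c j* , not (shift c j*))
    ... | no _  | yes _ = freshCube (pre ++ [ c ]) k
    ... | no _  | no _  = c k

    successor-at-j* : successor j* ≡ (label c j* , not (shift c j*))
    successor-at-j* with j* ≟F j*
    ... | yes _   = refl
    ... | no j≢j  = contradiction refl j≢j

    successor-reflects : Separated successor c j*
    successor-reflects = mk-sep (cong proj₁ successor-at-j*)
                                (λ same → not-¬ refl (sym (trans (sym (cong proj₂ successor-at-j*)) same)))

    successor-stale : Fresh pre c j* → ∀ {k} → ¬ Fresh pre c k → successor k ≡ c k
    successor-stale fresh* {k} stale with k ≟F j* | fresh? pre c k
    ... | yes refl | _       = contradiction fresh* stale
    ... | no _     | yes fresh = contradiction fresh stale
    ... | no _     | no _    = refl

    successor-fresh : ∀ {k} → k ≢ j* → Fresh pre c k → successor k ≡ freshCube (pre ++ [ c ]) k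
    successor-fresh {k} k≢j* fresh with k ≟F j* | fresh? pre c k
    ... | yes k≡j* | _       = contradiction k≡j* k≢j*
    ... | no _     | no stale = contradiction fresh stale
    ... | no _     | yes _   = refl

  successor-cube : ∀ {pre c} → Admissible pre c → 1 ≤ newParams pre c →
    Σ (Cube n) λ Y → Admissible (pre ++ [ c ]) Y × newParams pre c ≤ suc (newParams (pre ++ [ c ]) Y)
  successor-cube {pre} {c} admc pos with fresh-witness pre c pos
  ... | j* , fresh* = successor , ++⁺ admY ((j* , successor-reflects) ∷ []) , lose-one
    where
    open Successor pre c j*
    admY : Admissible pre successor
    admY = All.tabulate λ {d} d∈ →
      let (k , sep) = All.lookup admc d∈
      in k , separated-agree {d} c successor (successor-stale fresh* (separated-stale {X = c} d∈ sep)) sep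
    keeps : ∀ k → k ∉ j* ∷ [] → Fresh pre c k → Fresh (pre ++ [ c ]) successor k
    keeps k k∉ fresh = freshLabel-fresh {c = successor} k
                         (cong proj₁ (successor-fresh (k∉ ∘ here) fresh))
    lose-one : newParams pre c ≤ suc (newParams (pre ++ [ c ]) successor)
    lose-one = newParams-exchange {pre} {pre ++ [ c ]} {c} {successor} (j* ∷ []) [] keeps [] []

  walk-antitone : ∀ {acc c c′} → Good acc c → Good (acc ++ [ c ]) c′ →
    newParams (acc ++ [ c ]) c′ ≤ newParams acc c
  walk-antitone {acc} {c} {c′} (_ , maximal) (admc′ , _) =
    ≤-trans (newParams-antitone acc [ c ] c′) (maximal c′ (++⁻ˡ acc admc′))

  walk-unit-steps : ∀ {acc c c′} → Good acc c → Good (acc ++ [ c ]) c′ →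
    newParams acc c ≤ suc (newParams (acc ++ [ c ]) c′)
  walk-unit-steps {acc} {c} (admc , _) (_ , maximal′) with 1 ≤? newParams acc c
  ... | yes pos = let (Y , admY , le) = successor-cube admc pos in ≤-trans le (s≤s (maximal′ Y admY))
  ... | no ¬pos = ≤-trans (≤-pred (≰⇒> ¬pos)) z≤n

  last-cube-zero : ∀ {acc c} → Good acc c → Saturated (acc ++ [ c ]) → newParams acc c ≡ 0
  last-cube-zero {acc} {c} (admc , _) sat with 1 ≤? newParams acc c
  ... | yes pos = let (Y , admY , _) = successor-cube admc pos in contradiction admY (sat Y)
  ... | no ¬pos = n≤0⇒n≡0 (≤-pred (≰⇒> ¬pos))

hit : ℕ → ℕ → ℕ
hit v k = if ⌊ v ≟ℕ k ⌋ then 1 else 0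

hit-self : ∀ v → hit v v ≡ 1
hit-self v with v ≟ℕ v
... | yes _   = refl
... | no v≢v  = contradiction refl v≢v

hit-other : ∀ v k → v ≢ k → hit v k ≡ 0
hit-other v k v≢k with v ≟ℕ k
... | yes v≡k = contradiction v≡k v≢k
... | no _    = refl

module _ {n : ℕ} where

  NkGo-above : ∀ {acc r : List (Cube n)} {b} → Walk acc r →
    (∀ X → Admissible acc X → newParams acc X < b) → ∀ k → b ≤ k → NkGo k acc r ≡ 0
  NkGo-above [] bound k b≤k = refl
  NkGo-above {acc} {b = b} (_∷_ {c} (admc , _) w) bound k b≤k =
    cong₂ _+_ (hit-other _ k (<⇒≢ (<-≤-trans (bound c admc) b≤k))) (NkGo-above w bound′ k b≤k)
    where
    bound′ : ∀ X → Admissible (acc ++ [ c ]) X → newParams (acc ++ [ c ]) X < b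
    bound′ X admX = ≤-<-trans (newParams-antitone acc [ c ] X) (bound X (++⁻ˡ acc admX))

  NkGo-positive : ∀ {acc : List (Cube n)} {c r} k → Walk acc (c ∷ r) → Saturated (acc ++ c ∷ r) →
    k ≤ newParams acc c → 1 ≤ NkGo k acc (c ∷ r)
  NkGo-positive {acc} {c} k w sat k≤v with newParams acc c ≟ℕ k
  ... | yes _ = s≤s z≤n
  NkGo-positive {acc} {c} {[]} k (good ∷ []) sat k≤v | no v≢k =
    contradiction (≤-antisym (≤-trans (≤-reflexive (last-cube-zero good sat)) z≤n) k≤v) v≢k
  NkGo-positive {acc} {c} {c′ ∷ r} k (good ∷ w@(good′ ∷ _)) sat k≤v | no v≢k =
    NkGo-positive k w (subst Saturated (sym (++-assoc acc [ c ] (c′ ∷ r))) sat)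
      (≤-pred (≤-trans (≤∧≢⇒< k≤v (v≢k ∘ sym)) (walk-unit-steps good good′)))

-- Layers: after C₁ and C₂ (separated at j₀), cubes with z_{j₀} ∈ {a, a+1}, a = label C₁ j₀.
module Layer {n : ℕ} (j₀ : Fin n) (a : ℕ) where

  record Layered (pre : List (Cube n)) : Set where
    field
      in-layer       : ∀ {x} → x ∈ pre → label x j₀ ≡ a
      sides-disjoint : ∀ {x y} → x ∈ pre → y ∈ pre → shift x j₀ ≢ shift y j₀ →
                       ∀ j → j ≢ j₀ → label x j ≢ label y j
  open Layered public

  Apart : Cube n → Cube n → Set
  Apart P Q = ∀ k → k ≢ j₀ → ApartAt P Q k

  Lone : List (Cube n) → Cube n → Set
  Lone pre U = ∀ {d} → d ∈ pre → shift d j₀ ≡ shift U j₀ → d ≡ U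

  opposite-apart : ∀ {pre d e} → Layered pre → d ∈ pre → e ∈ pre → shift d j₀ ≢ shift e j₀ →
    ∀ k → ApartAt d e k
  opposite-apart L d∈ e∈ sides k with k ≟F j₀
  ... | yes refl = λ _ → sides
  ... | no k≢j₀  = λ same → contradiction same (sides-disjoint L d∈ e∈ sides k k≢j₀)

  off-layer-separation : ∀ {pre X d k} → Layered pre → label X j₀ ≢ a → d ∈ pre →
    Separated X d k → k ≢ j₀
  off-layer-separation L off d∈ (mk-sep same _) refl = off (trans same (in-layer L d∈))

  same-side-separation : ∀ {X d k} → shift X j₀ ≡ shift d j₀ → Separated X d k → k ≢ j₀
  same-side-separation side (mk-sep _ opposite) refl = opposite side

  good-opposite-disjoint : ∀ {pre X y} → Layered pre → Good pre X → label X j₀ ≡ a → y ∈ pre →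
    shift y j₀ ≢ shift X j₀ → ∀ j → j ≢ j₀ → label y j ≢ label X j
  good-opposite-disjoint {pre} {X} {y} L good inX y∈ side j j≢j₀ y≡X =
    All.lookup (distinct-from $ good-fresh good j elsewhere) y∈ y≡X
    where
    elsewhere : ∀ {d} → d ∈ pre → Σ (Fin n) λ k → k ≢ j × Separated X d k
    elsewhere {d} d∈ with shift d j₀ ≟B shift X j₀
    ... | no other = j₀ , j≢j₀ ∘ sym , mk-sep (trans inX (sym (in-layer L d∈))) (other ∘ sym)
    ... | yes same with All.lookup (proj₁ good) d∈
    ...   | k , sep with k ≟F j
    ...     | no k≢j   = k , k≢j , sep
    ...     | yes refl = contradiction (trans (sym (same-label sep)) (sym y≡X))
                           (sides-disjoint L d∈ y∈ (λ d≡y → side (trans (sym d≡y) same)) j j≢j₀)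

  layered-snoc : ∀ {pre X} → Layered pre → Good pre X → label X j₀ ≡ a → Layered (pre ++ [ X ])
  layered-snoc {pre} {X} L good inX = record { in-layer = in-layer′ ; sides-disjoint = disjoint′ }
    where
    in-layer′ : ∀ {x} → x ∈ pre ++ [ X ] → label x j₀ ≡ a
    in-layer′ x∈ with ∈-++⁻ pre x∈
    ... | inj₁ x∈pre       = in-layer L x∈pre
    ... | inj₂ (here refl) = inX
    disjoint′ : ∀ {x y} → x ∈ pre ++ [ X ] → y ∈ pre ++ [ X ] → shift x j₀ ≢ shift y j₀ →
      ∀ j → j ≢ j₀ → label x j ≢ label y j
    disjoint′ x∈ y∈ sides j j≢j₀ with ∈-++⁻ pre x∈ | ∈-++⁻ pre y∈
    ... | inj₁ x∈pre       | inj₁ y∈pre       = sides-disjoint L x∈pre y∈pre sides j j≢j₀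
    ... | inj₁ x∈pre       | inj₂ (here refl) = good-opposite-disjoint L good inX x∈pre sides j j≢j₀
    ... | inj₂ (here refl) | inj₁ y∈pre       =
          good-opposite-disjoint L good inX y∈pre (sides ∘ sym) j j≢j₀ ∘ sym
    ... | inj₂ (here refl) | inj₂ (here refl) = contradiction refl sides

  good-apart : ∀ {pre X U} → Layered pre → Good pre X → U ∈ pre → Lone pre U → Apart U X
  good-apart {pre} {X} {U} L good U∈ lone k k≢j₀ U≡X same-shift =
    All.lookup (distinct-from $ good-fresh good k elsewhere) U∈ U≡X
    where
    elsewhere : ∀ {d} → d ∈ pre → Σ (Fin n) λ m → m ≢ k × Separated X d m
    elsewhere {d} d∈ with All.lookup (proj₁ good) d∈
    ... | m , sep with m ≟F k
    ...   | no m≢k   = m , m≢k , sep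
    ...   | yes refl with shift d j₀ ≟B shift U j₀
    ...     | yes side = contradiction (sym same-shift) (subst (λ u → shift X k ≢ shift u k) (lone d∈ side) (opposite-side sep))
    ...     | no side = contradiction (trans (sym (same-label sep)) (sym U≡X)) (sides-disjoint L d∈ U∈ side k k≢j₀)

  same-side-bound : ∀ {pre X P Q} → Layered pre → Admissible pre X → label X j₀ ≡ a →
    P ∈ pre → Q ∈ pre → shift X j₀ ≡ shift P j₀ → shift X j₀ ≡ shift Q j₀ → Apart P Q →
    3 + newParams pre X ≤ n
  same-side-bound {pre} {X} L adm inX P∈ Q∈ XP XQ apart with All.lookup adm P∈ | All.lookup adm Q∈
  ... | k₁ , sep₁ | k₂ , sep₂ =
    newParams-stale (j₀ ∷ k₁ ∷ k₂ ∷ []) (distinct₃ (k₁≢j₀ ∘ sym) (k₂≢j₀ ∘ sym) k₁≢k₂)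
      (stale₀ ∷ separated-stale P∈ sep₁ ∷ separated-stale Q∈ sep₂ ∷ [])
    where
    k₁≢j₀ : k₁ ≢ j₀
    k₁≢j₀ = same-side-separation XP sep₁
    k₂≢j₀ : k₂ ≢ j₀
    k₂≢j₀ = same-side-separation XQ sep₂
    k₁≢k₂ : k₁ ≢ k₂
    k₁≢k₂ = separation-coords-differ sep₁ sep₂ (apart k₁ k₁≢j₀)
    stale₀ : ¬ Fresh pre X j₀
    stale₀ fresh = All.lookup (distinct-from fresh) P∈ (trans (in-layer L P∈) (sym inX))

  off-layer-bound : ∀ {pre X P Q R} → Layered pre → Admissible pre X → label X j₀ ≢ a →
    P ∈ pre → Q ∈ pre → R ∈ pre → shift P j₀ ≡ shift Q j₀ → shift P j₀ ≢ shift R j₀ →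
    Apart P Q → 3 + newParams pre X ≤ n
  off-layer-bound {pre} {X} L adm off P∈ Q∈ R∈ PQ PR apart
    with All.lookup adm P∈ | All.lookup adm Q∈ | All.lookup adm R∈
  ... | k₁ , sep₁ | k₂ , sep₂ | k₃ , sep₃ =
    newParams-stale (k₁ ∷ k₂ ∷ k₃ ∷ []) (distinct₃ k₁≢k₂ k₁≢k₃ k₂≢k₃)
      (separated-stale P∈ sep₁ ∷ separated-stale Q∈ sep₂ ∷ separated-stale R∈ sep₃ ∷ [])
    where
    k₁≢k₂ : k₁ ≢ k₂
    k₁≢k₂ = separation-coords-differ sep₁ sep₂ (apart k₁ (off-layer-separation L off P∈ sep₁))
    k₁≢k₃ : k₁ ≢ k₃
    k₁≢k₃ = separation-coords-differ sep₁ sep₃ (opposite-apart L P∈ R∈ PR k₁)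
    k₂≢k₃ : k₂ ≢ k₃
    k₂≢k₃ = separation-coords-differ sep₂ sep₃ (opposite-apart L Q∈ R∈ (PR ∘ trans PQ) k₂)

  two-pairs-bound : ∀ {pre X P Q R S} → Layered pre →
    P ∈ pre → Q ∈ pre → shift P j₀ ≡ shift Q j₀ → Apart P Q →
    R ∈ pre → S ∈ pre → shift R j₀ ≡ shift S j₀ → Apart R S → shift P j₀ ≢ shift R j₀ →
    Admissible pre X → 3 + newParams pre X ≤ n
  two-pairs-bound {X = X} {P} {R = R} L P∈ Q∈ PQ apartPQ R∈ S∈ RS apartRS PR adm
    with label X j₀ ≟ℕ a | shift X j₀ ≟B shift P j₀
  ... | no off | _      = off-layer-bound L adm off P∈ Q∈ R∈ PQ PR apartPQ
  ... | yes inX | yes XP = same-side-bound L adm inX P∈ Q∈ XP (trans XP PQ) apartPQ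
  ... | yes inX | no ¬XP =
        same-side-bound L adm inX R∈ S∈ XR (trans XR RS) apartRS
    where
    XR : shift X j₀ ≡ shift R j₀
    XR = two-sides (λ P≡X → ¬XP (sym P≡X)) PR

  -- Once one side holds an apart pair, every good cube stays in the layer: otherwise
  -- moving it into the layer (opposite to the pair) and refreshing the two coordinates
  -- where it meets the pair would gain two new parameters for the one lost at j₀.
  good-in-layer : ∀ {pre X P Q} → Layered pre → Good pre X → P ∈ pre → Q ∈ pre →
    shift P j₀ ≡ shift Q j₀ → Apart P Q → label X j₀ ≡ a
  good-in-layer {pre} {X} {P} {Q} L good P∈ Q∈ PQ apart
    with label X j₀ ≟ℕ a | All.lookup (proj₁ good) P∈ | All.lookup (proj₁ good) Q∈
  ... | yes inX | _ | _ = inX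
  ... | no off  | k₁ , sep₁ | k₂ , sep₂ = contradiction
        (good-exchange good admY (j₀ ∷ []) (k₁ ∷ k₂ ∷ []) keeps (distinct₂ k₁≢k₂) gains)
        λ { (s≤s ()) }
    where
    k₁≢j₀ : k₁ ≢ j₀
    k₁≢j₀ = off-layer-separation L off P∈ sep₁
    k₂≢j₀ : k₂ ≢ j₀
    k₂≢j₀ = off-layer-separation L off Q∈ sep₂
    k₁≢k₂ : k₁ ≢ k₂
    k₁≢k₂ = separation-coords-differ sep₁ sep₂ (apart k₁ k₁≢j₀)
    Y : Cube n
    Y = ((X [ j₀ ]≔ (a , not (shift P j₀))) [ k₁ ]≔ freshCube pre k₁) [ k₂ ]≔ freshCube pre k₂
    Y-k₁ : Y k₁ ≡ freshCube pre k₁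
    Y-k₁ = trans (≔-there _ k₂ _ k₁≢k₂) (≔-here _ k₁ _)
    Y-k₂ : Y k₂ ≡ freshCube pre k₂
    Y-k₂ = ≔-here _ k₂ _
    Y-j₀ : Y j₀ ≡ (a , not (shift P j₀))
    Y-j₀ = trans (≔-there _ k₂ _ (k₂≢j₀ ∘ sym)) (trans (≔-there _ k₁ _ (k₁≢j₀ ∘ sym)) (≔-here X j₀ _))
    Y-elsewhere : ∀ {k} → k ≢ j₀ → k ≢ k₁ → k ≢ k₂ → Y k ≡ X k
    Y-elsewhere k≢j₀ k≢k₁ k≢k₂ =
      trans (≔-there _ k₂ _ k≢k₂) (trans (≔-there _ k₁ _ k≢k₁) (≔-there X j₀ _ k≢j₀))
    -- cubes on P's side are met at j₀, the others where X met them (not at k₁, k₂)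
    admY : Admissible pre Y
    admY = All.tabulate λ {d} d∈ → meet d∈ (shift d j₀ ≟B shift P j₀)
      where
      meet : ∀ {d} → d ∈ pre → Dec (shift d j₀ ≡ shift P j₀) → ∃ (Separated Y d)
      meet d∈ (yes dP) = j₀ , mk-sep (trans (cong proj₁ Y-j₀) (sym (in-layer L d∈)))
                                      (λ same → not-¬ refl (sym (trans (sym (cong proj₂ Y-j₀)) (trans same dP))))
      meet {d} d∈ (no ¬dP) with All.lookup (proj₁ good) d∈
      ... | m , sep = m , separated-agree X Y (Y-elsewhere (off-layer-separation L off d∈ sep) m≢k₁ m≢k₂) sep
        where
        m≢k₁ : m ≢ k₁
        m≢k₁ = separation-coords-differ sep sep₁ (opposite-apart L d∈ P∈ ¬dP m)
        m≢k₂ : m ≢ k₂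
        m≢k₂ = separation-coords-differ sep sep₂ (opposite-apart L d∈ Q∈ (λ dQ → ¬dP (trans dQ (sym PQ))) m)
    keeps : ∀ k → k ∉ j₀ ∷ [] → Fresh pre X k → Fresh pre Y k
    keeps k k∉ fresh with k ≟F k₁ | k ≟F k₂
    ... | yes refl | _        = freshLabel-fresh k (cong proj₁ Y-k₁)
    ... | no _     | yes refl = freshLabel-fresh k (cong proj₁ Y-k₂)
    ... | no k≢k₁  | no k≢k₂  = fresh-agree X Y (Y-elsewhere (k∉ ∘ here) k≢k₁ k≢k₂) fresh
    gains : All (λ k → ¬ Fresh pre X k × Fresh pre Y k) (k₁ ∷ k₂ ∷ [])
    gains = (separated-stale P∈ sep₁ , freshLabel-fresh k₁ (cong proj₁ Y-k₁))
          ∷ (separated-stale Q∈ sep₂ , freshLabel-fresh k₂ (cong proj₁ Y-k₂)) ∷ []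

  walk-in-layer : ∀ {acc r P Q} → Walk acc r → Layered acc → P ∈ acc → Q ∈ acc →
    shift P j₀ ≡ shift Q j₀ → Apart P Q → All (λ c → label c j₀ ≡ a) r
  walk-in-layer [] _ _ _ _ _ = []
  walk-in-layer (_∷_ {c} good w) L P∈ Q∈ PQ apart =
    inC ∷ walk-in-layer w (layered-snoc L good inC) (∈-++⁺ˡ P∈) (∈-++⁺ˡ Q∈) PQ apart
    where
    inC : label c j₀ ≡ a
    inC = good-in-layer L good P∈ Q∈ PQ apart

  layer-completion : ∀ {pre R} (k : Fin n) → k ≢ j₀ → Layered pre → Lone pre R →
    Σ (Cube n) λ Z → Admissible pre Z × n ≤ 2 + newParams pre Z
  layer-completion {pre} {R} k k≢j₀ L lone = Z , admZ , newParams-cover (j₀ ∷ k ∷ []) freshZ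
    where
    Z : Cube n
    Z = (freshCube pre [ j₀ ]≔ (a , shift R j₀)) [ k ]≔ (label R k , not (shift R k))
    Z-k : Z k ≡ (label R k , not (shift R k))
    Z-k = ≔-here _ k _
    Z-j₀ : Z j₀ ≡ (a , shift R j₀)
    Z-j₀ = trans (≔-there _ k _ (k≢j₀ ∘ sym)) (≔-here _ j₀ _)
    admZ : Admissible pre Z
    admZ = All.tabulate λ {d} d∈ → meet d∈ (shift d j₀ ≟B shift R j₀)
      where
      meet : ∀ {d} → d ∈ pre → Dec (shift d j₀ ≡ shift R j₀) → ∃ (Separated Z d)
      meet d∈ (yes dR) with lone d∈ dR
      ... | refl = k , mk-sep (cong proj₁ Z-k) (λ same → not-¬ refl (sym (trans (sym (cong proj₂ Z-k)) same)))
      meet d∈ (no ¬dR) = j₀ , mk-sep (trans (cong proj₁ Z-j₀) (sym (in-layer L d∈)))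
                                      (λ same → ¬dR (trans (sym same) (cong proj₂ Z-j₀)))
    freshZ : ∀ j → j ∉ j₀ ∷ k ∷ [] → Fresh pre Z j
    freshZ j j∉ = freshLabel-fresh j (cong proj₁
      (trans (≔-there _ k _ (j∉ ∘ there ∘ here)) (≔-there _ j₀ _ (j∉ ∘ here))))

TopCounts : (n : ℕ) → List (Cube n) → Set
TopCounts n p = ((Nk n p ≡ 1) × (Nk (n ∸ 1) p ≡ 1)) ×
                ((Nk (n ∸ 2) p ≤ 2) × ((Nk (n ∸ 2) p ≡ 2) ⇔ Laminated p))

module Offsets (m : ℕ) where
  m≤2+m : m ≤ 2 + m
  m≤2+m = ≤-trans (n≤1+n m) (n≤1+n (suc m))
  h₀₁ : hit m (1 + m) ≡ 0
  h₀₁ = hit-other _ _ (<⇒≢ ≤-refl)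
  h₀₂ : hit m (2 + m) ≡ 0
  h₀₂ = hit-other _ _ (<⇒≢ (s≤s (n≤1+n m)))
  h₁₀ : hit (1 + m) m ≡ 0
  h₁₀ = hit-other _ _ (>⇒≢ ≤-refl)
  h₁₂ : hit (1 + m) (2 + m) ≡ 0
  h₁₂ = hit-other _ _ (<⇒≢ ≤-refl)
  h₂₀ : hit (2 + m) m ≡ 0
  h₂₀ = hit-other _ _ (>⇒≢ (s≤s (n≤1+n m)))
  h₂₁ : hit (2 + m) (1 + m) ≡ 0
  h₂₁ = hit-other _ _ (>⇒≢ ≤-refl)

top-three : ∀ m {s₁ s₂ s₃} (t : ℕ → ℕ) → s₁ ≡ 2 + m → s₂ ≡ 1 + m → s₃ ≡ m →
  (∀ k → m ≤ k → t k ≡ 0) →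
  let N = λ k → hit s₁ k + (hit s₂ k + (hit s₃ k + t k)) in
  (N (2 + m) ≡ 1) × (N (1 + m) ≡ 1) × (N m ≡ 1)
top-three m t refl refl refl tail =
  cong₂ _+_ (hit-self (2 + m)) (cong₂ _+_ h₁₂ (cong₂ _+_ h₀₂ (tail _ m≤2+m))) ,
  cong₂ _+_ h₂₁ (cong₂ _+_ (hit-self (1 + m)) (cong₂ _+_ h₀₁ (tail _ (n≤1+n m)))) ,
  cong₂ _+_ h₂₀ (cong₂ _+_ h₁₀ (cong₂ _+_ (hit-self m) (tail _ ≤-refl)))
  where open Offsets m

top-four : ∀ m {s₁ s₂ s₃ s₄} (t : ℕ → ℕ) → s₁ ≡ 2 + m → s₂ ≡ 1 + m → s₃ ≡ m → s₄ ≡ m →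
  (∀ k → m ≤ k → t k ≡ 0) →
  let N = λ k → hit s₁ k + (hit s₂ k + (hit s₃ k + (hit s₄ k + t k))) in
  (N (2 + m) ≡ 1) × (N (1 + m) ≡ 1) × (N m ≡ 2)
top-four m t refl refl refl refl tail =
  cong₂ _+_ (hit-self (2 + m)) (cong₂ _+_ h₁₂ (cong₂ _+_ h₀₂ (cong₂ _+_ h₀₂ (tail _ m≤2+m)))) ,
  cong₂ _+_ h₂₁ (cong₂ _+_ (hit-self (1 + m)) (cong₂ _+_ h₀₁ (cong₂ _+_ h₀₁ (tail _ (n≤1+n m))))) ,
  cong₂ _+_ h₂₀ (cong₂ _+_ h₁₀ (cong₂ _+_ (hit-self m) (cong₂ _+_ (hit-self m) (tail _ ≤-refl))))
  where open Offsets m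

-- (i)-(ii) from the values: off the layer no value repeats, in the layer n - 2 repeats once.
top-counts-unlaminated : ∀ {m} {C₁ C₂ C₃ : Cube (2 + m)} {r} →
  newParams [] C₁ ≡ 2 + m → newParams (C₁ ∷ []) C₂ ≡ 1 + m → newParams (C₁ ∷ C₂ ∷ []) C₃ ≡ m →
  (∀ k → m ≤ k → NkGo k (C₁ ∷ C₂ ∷ C₃ ∷ []) r ≡ 0) → ¬ Laminated (C₁ ∷ C₂ ∷ C₃ ∷ r) →
  TopCounts (2 + m) (C₁ ∷ C₂ ∷ C₃ ∷ r)
top-counts-unlaminated {m} {r = r} v₁ v₂ v₃ tail ¬laminated =
  let (N₂ , N₁ , N₀) = top-three m (λ k → NkGo k _ r) v₁ v₂ v₃ tail in
  (N₂ , N₁) , ≤-trans (≤-reflexive N₀) (s≤s z≤n) ,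
  mk⇔ (λ N₀≡2 → contradiction (trans (sym N₀) N₀≡2) λ ()) (λ laminated → contradiction laminated ¬laminated)

top-counts-laminated : ∀ {m} {C₁ C₂ C₃ C₄ : Cube (2 + m)} {r} →
  newParams [] C₁ ≡ 2 + m → newParams (C₁ ∷ []) C₂ ≡ 1 + m → newParams (C₁ ∷ C₂ ∷ []) C₃ ≡ m →
  newParams (C₁ ∷ C₂ ∷ C₃ ∷ []) C₄ ≡ m →
  (∀ k → m ≤ k → NkGo k (C₁ ∷ C₂ ∷ C₃ ∷ C₄ ∷ []) r ≡ 0) → Laminated (C₁ ∷ C₂ ∷ C₃ ∷ C₄ ∷ r) →
  TopCounts (2 + m) (C₁ ∷ C₂ ∷ C₃ ∷ C₄ ∷ r)
top-counts-laminated {m} {r = r} v₁ v₂ v₃ v₄ tail laminated =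
  let (N₂ , N₁ , N₀) = top-four m (λ k → NkGo k _ r) v₁ v₂ v₃ v₄ tail in
  (N₂ , N₁) , ≤-reflexive N₀ , mk⇔ (const laminated) (const N₀)

module Opening {m : ℕ} {C₁ C₂ : Cube (2 + m)} {j₀ : Fin (2 + m)}
  (sep : Separated C₂ C₁ j₀) (g₁ : Good [] C₁) (g₂ : Good (C₁ ∷ []) C₂) where

  a : ℕ
  a = label C₁ j₀
  open Layer j₀ a

  L₂ : List (Cube (2 + m))
  L₂ = C₁ ∷ C₂ ∷ []

  sides : shift C₁ j₀ ≢ shift C₂ j₀
  sides = opposite-side sep ∘ sym

  layered₂ : Layered L₂
  layered₂ = layered-snoc layered₁ g₂ (same-label sep)
    where
    layered₁ : Layered (C₁ ∷ [])
    layered₁ = record { in-layer       = λ { (here refl) → refl }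
                      ; sides-disjoint = λ { (here refl) (here refl) s → contradiction refl s } }

  lone₁ : Lone L₂ C₁
  lone₁ (here refl)         _  = refl
  lone₁ (there (here refl)) e  = contradiction (sym e) sides

  lone₂ : Lone L₂ C₂
  lone₂ (here refl)         e  = contradiction e sides
  lone₂ (there (here refl)) _  = refl

  v₁ : newParams [] C₁ ≡ 2 + m
  v₁ = newParams-[] C₁

  v₂ : newParams (C₁ ∷ []) C₂ ≡ 1 + m
  v₂ = ≤-antisym (≤-pred (newParams-stale (j₀ ∷ []) ([] ∷ []) (separated-stale (here refl) sep ∷ [])))
                 (≤-pred (subst (_≤ suc (newParams (C₁ ∷ []) C₂)) v₁ (walk-unit-steps g₁ g₂)))

  -- The third cube meets C₁ and C₂ at two distinct coordinates, so it has n - 2 new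
  -- parameters; whether it stays in the layer decides lamination.
  module Third {C₃ : Cube (2 + m)} (g₃ : Good L₂ C₃) where

    L₃ : List (Cube (2 + m))
    L₃ = C₁ ∷ C₂ ∷ C₃ ∷ []

    v₃ : newParams L₂ C₃ ≡ m
    v₃ = ≤-antisym (+-cancelˡ-≤ 2 _ _ upper)
                   (≤-pred (subst (_≤ suc (newParams L₂ C₃)) v₂ (walk-unit-steps g₂ g₃)))
      where
      upper : 2 + newParams L₂ C₃ ≤ 2 + m
      upper with All.lookup (proj₁ g₃) (here refl) | All.lookup (proj₁ g₃) (there (here refl))
      ... | k₁ , sep₁ | k₂ , sep₂ =
        newParams-stale (k₁ ∷ k₂ ∷ []) (distinct₂ k₁≢k₂)
          (separated-stale (here refl) sep₁ ∷ separated-stale (there (here refl)) sep₂ ∷ [])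
        where
        k₁≢k₂ : k₁ ≢ k₂
        k₁≢k₂ = separation-coords-differ sep₁ sep₂ (opposite-apart layered₂ (here refl) (there (here refl)) sides k₁)

    -- C₃ leaves the layer: every later cube meets C₁, C₂, C₃ at distinct coordinates, and
    -- no coordinate is common to all cubes.
    leaves-layer : ∀ {r} → label C₃ j₀ ≢ a → Walk L₃ r → TopCounts (2 + m) (C₁ ∷ C₂ ∷ C₃ ∷ r)
    leaves-layer {r} off w = top-counts-unlaminated v₁ v₂ v₃ (NkGo-above w below) ¬laminated
      where
      C₃-apart : ∀ {U} → U ∈ L₂ → Lone L₂ U → ∀ k → ApartAt U C₃ k
      C₃-apart U∈ lone k with k ≟F j₀
      ... | yes refl = λ same _ → off (trans (sym same) (in-layer layered₂ U∈))
      ... | no k≢j₀  = good-apart layered₂ g₃ U∈ lone k k≢j₀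
      below : ∀ X → Admissible L₃ X → newParams L₃ X < m
      below X adm with All.lookup adm (here refl) | All.lookup adm (there (here refl))
                     | All.lookup adm (there (there (here refl)))
      ... | k₁ , sep₁ | k₂ , sep₂ | k₃ , sep₃ =
        ≤-pred (≤-pred (newParams-stale (k₁ ∷ k₂ ∷ k₃ ∷ []) (distinct₃ k₁≢k₂ k₁≢k₃ k₂≢k₃)
          (separated-stale (here refl) sep₁ ∷ separated-stale (there (here refl)) sep₂ ∷
           separated-stale (there (there (here refl))) sep₃ ∷ [])))
        where
        k₁≢k₂ : k₁ ≢ k₂
        k₁≢k₂ = separation-coords-differ sep₁ sep₂ (opposite-apart layered₂ (here refl) (there (here refl)) sides k₁)
        k₁≢k₃ : k₁ ≢ k₃
        k₁≢k₃ = separation-coords-differ sep₁ sep₃ (C₃-apart (here refl) lone₁ k₁)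
        k₂≢k₃ : k₂ ≢ k₃
        k₂≢k₃ = separation-coords-differ sep₂ sep₃ (C₃-apart (there (here refl)) lone₂ k₂)
      ¬laminated : ¬ Laminated (C₁ ∷ C₂ ∷ C₃ ∷ r)
      ¬laminated (j , t , t₁ ∷ t₂ ∷ t₃ ∷ _) with j ≟F j₀
      ... | yes refl = off (trans t₃ (sym t₁))
      ... | no j≢j₀  = sides-disjoint layered₂ (here refl) (there (here refl)) sides j j≢j₀ (trans t₁ (sym t₂))

    record Split : Set where
      field
        P Q R : Cube (2 + m)
        P∈    : P ∈ L₃
        Q∈    : Q ∈ L₃
        R∈    : R ∈ L₃
        PQ    : shift P j₀ ≡ shift Q j₀
        PR    : shift P j₀ ≢ shift R j₀
        apart : Apart P Q
        lone  : Lone L₃ R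

    split : label C₃ j₀ ≡ a → Split
    split inC₃ with shift C₃ j₀ ≟B shift C₂ j₀
    ... | yes C₃C₂ = record { P = C₂ ; Q = C₃ ; R = C₁ ; P∈ = there (here refl) ; Q∈ = there (there (here refl))
                            ; R∈ = here refl ; PQ = sym C₃C₂ ; PR = sides ∘ sym
                            ; apart = good-apart layered₂ g₃ (there (here refl)) lone₂ ; lone = lone-C₁ }
      where
      lone-C₁ : Lone L₃ C₁
      lone-C₁ (here refl)                 _ = refl
      lone-C₁ (there (here refl))         e = contradiction (sym e) sides
      lone-C₁ (there (there (here refl))) e = contradiction (trans (sym e) C₃C₂) sides
    ... | no ¬C₃C₂ = record { P = C₁ ; Q = C₃ ; R = C₂ ; P∈ = here refl ; Q∈ = there (there (here refl))
                            ; R∈ = there (here refl) ; PQ = sym C₃C₁ ; PR = sides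
                            ; apart = good-apart layered₂ g₃ (here refl) lone₁ ; lone = lone-C₂ }
      where
      C₃C₁ : shift C₃ j₀ ≡ shift C₁ j₀
      C₃C₁ = two-sides (λ C₂C₃ → ¬C₃C₂ (sym C₂C₃)) (λ C₂C₁ → sides (sym C₂C₁))
      lone-C₂ : Lone L₃ C₂
      lone-C₂ (here refl)                 e = contradiction e sides
      lone-C₂ (there (here refl))         _ = refl
      lone-C₂ (there (there (here refl))) e = contradiction e ¬C₃C₂

    module InLayer (inC₃ : label C₃ j₀ ≡ a) where
      open Split (split inC₃) public

      layered₃ : Layered L₃
      layered₃ = layered-snoc layered₂ g₃ inC₃

      completion : Σ (Cube (2 + m)) λ Z → Admissible L₃ Z × 2 + m ≤ 2 + newParams L₃ Z
      completion = layer-completion (punchIn j₀ fzero) (punchInᵢ≢i j₀ fzero) layered₃ lone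

    -- C₃ stays in the layer: C₄ completes R's side with another n - 2 new parameters, the
    -- layer then has apart pairs on both sides, so all later values are below n - 2, and
    -- every later cube stays in the layer.
    stays-in-layer : ∀ {r} → label C₃ j₀ ≡ a → Walk L₃ r → Saturated (C₁ ∷ C₂ ∷ C₃ ∷ r) →
      TopCounts (2 + m) (C₁ ∷ C₂ ∷ C₃ ∷ r)
    stays-in-layer {[]} inC₃ [] sat = contradiction (proj₁ (proj₂ completion)) (sat (proj₁ completion))
      where open InLayer inC₃
    stays-in-layer {C₄ ∷ r} inC₃ (g₄ ∷ w) sat =
      top-counts-laminated v₁ v₂ v₃ v₄ (NkGo-above w below) laminated
      where
      open InLayer inC₃
      v₄ : newParams L₃ C₄ ≡ m
      v₄ = ≤-antisym (subst (newParams L₃ C₄ ≤_) v₃ (walk-antitone g₃ g₄))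
                     (+-cancelˡ-≤ 2 _ _ (≤-trans (proj₂ (proj₂ completion))
                                                (+-monoʳ-≤ 2 (proj₂ g₄ _ (proj₁ (proj₂ completion))))))
      inC₄ : label C₄ j₀ ≡ a
      inC₄ = good-in-layer layered₃ g₄ P∈ Q∈ PQ apart
      C₄R : shift C₄ j₀ ≡ shift R j₀
      C₄R with shift C₄ j₀ ≟B shift P j₀
      ... | yes C₄P = contradiction (≤-pred (≤-pred (subst (λ v → 3 + v ≤ 2 + m) v₄
                        (same-side-bound layered₃ (proj₁ g₄) inC₄ P∈ Q∈ C₄P (trans C₄P PQ) apart)))) (1+n≰n {m})
      ... | no ¬C₄P = two-sides (λ PC₄ → ¬C₄P (sym PC₄)) PR
      layered₄ : Layered (L₃ ++ [ C₄ ])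
      layered₄ = layered-snoc layered₃ g₄ inC₄
      below : ∀ X → Admissible (L₃ ++ [ C₄ ]) X → newParams (L₃ ++ [ C₄ ]) X < m
      below X adm = ≤-pred (≤-pred (two-pairs-bound layered₄ (∈-++⁺ˡ P∈) (∈-++⁺ˡ Q∈) PQ apart
                      (∈-++⁺ˡ R∈) (∈-++⁺ʳ L₃ (here refl)) (sym C₄R) (good-apart layered₃ g₄ R∈ lone) PR adm))
      laminated : Laminated (C₁ ∷ C₂ ∷ C₃ ∷ C₄ ∷ r)
      laminated = j₀ , a , refl ∷ same-label sep ∷ inC₃ ∷ inC₄ ∷
                  walk-in-layer w layered₄ (∈-++⁺ˡ P∈) (∈-++⁺ˡ Q∈) PQ apart

-- Parts (i) and (ii) for a walk of good cubes forming a saturated family with fewer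
-- than 2^n cubes (the bound only excludes the full packings in dimensions 0 and 1).
top-counts : ∀ n (p : List (Cube n)) → Walk [] p → Saturated p → length p < 2 ^ n → TopCounts n p
top-counts n             []            _              sat _ = contradiction [] (sat (freshCube []))
top-counts zero          (_ ∷ _)       _              _   (s≤s ())
top-counts (suc n)       (C₁ ∷ [])     (g₁ ∷ [])      sat _ =
  contradiction (trans (sym (newParams-[] C₁)) (last-cube-zero g₁ sat)) λ ()
top-counts (suc zero)    (_ ∷ _ ∷ _)   _              _   (s≤s (s≤s ()))
top-counts (suc (suc m)) (C₁ ∷ C₂ ∷ r) (g₁ ∷ g₂ ∷ w) sat _ with All.head (proj₁ g₂)
... | j₀ , sep = after-two r w sat
  where
  open Opening sep g₁ g₂
  after-two : ∀ r → Walk L₂ r → Saturated (C₁ ∷ C₂ ∷ r) → TopCounts (2 + m) (C₁ ∷ C₂ ∷ r)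
  after-two []       []        sat = contradiction (trans (sym v₂) (last-cube-zero g₂ sat)) λ ()
  after-two (C₃ ∷ r) (g₃ ∷ w) sat with label C₃ j₀ ≟ℕ a
  ... | no off   = Third.leaves-layer g₃ off w
  ... | yes inC₃ = Third.stays-in-layer g₃ inC₃ w sat

module DistinctCount {A : Set} (_≟_ : DecidableEquality A) where

  distinct : List A → ℕ
  distinct xs = length (deduplicate _≟_ xs)

  unique-length : ∀ {us vs : List A} → Unique us → us ⊆ vs → length us ≤ length vs
  unique-length {[]}     _                 _     = z≤n
  unique-length {x ∷ us} (x∉us ∷ unique) us⊆vs with ∈-∃++ (us⊆vs (here refl))
  ... | xs , ys , refl =
    ≤-trans (s≤s (unique-length unique us⊆xs++ys)) (≤-reflexive (sym (length-++-sucʳ xs x ys)))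
    where
    us⊆xs++ys : us ⊆ xs ++ ys
    us⊆xs++ys {z} z∈ with ∈-++⁻ xs (us⊆vs (there z∈))
    ... | inj₁ z∈xs         = ∈-++⁺ˡ z∈xs
    ... | inj₂ (here refl)  = contradiction refl (All.lookup x∉us z∈)
    ... | inj₂ (there z∈ys) = ∈-++⁺ʳ xs z∈ys

  distinct-cong : ∀ {xs ys} → xs ⊆ ys → ys ⊆ xs → distinct xs ≡ distinct ys
  distinct-cong {xs} {ys} xs⊆ys ys⊆xs = ≤-antisym (via xs⊆ys) (via ys⊆xs)
    where
    via : ∀ {us vs} → us ⊆ vs → distinct us ≤ distinct vs
    via {us} {vs} us⊆vs = unique-length (deduplicate-! _≟_ us)
      (∈-deduplicate⁺ _≟_ ∘ us⊆vs ∘ ∈-deduplicate⁻ _≟_ us)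

  _∉?_ : (z : A) (xs : List A) → Dec (z ∉ xs)
  z ∉? xs = ¬? (Any.any? (z ≟_) xs)

  distinct-++ : ∀ xs {ys} → Unique ys → distinct (xs ++ ys) ≡ distinct xs + length (filter (_∉? xs) ys)
  distinct-++ xs {ys} unique-ys = begin
    distinct (xs ++ ys)                                     ≡⟨ same-length ⟩
    length (deduplicate _≟_ xs ++ filter (_∉? xs) ys)       ≡⟨ length-++ (deduplicate _≟_ xs) ⟩
    distinct xs + length (filter (_∉? xs) ys)               ∎
    where
    open ≡-Reasoning
    Z : List A
    Z = deduplicate _≟_ xs ++ filter (_∉? xs) ys
    unique-Z : Unique Z
    unique-Z = UP.++⁺ (deduplicate-! _≟_ xs) (UP.filter⁺ (_∉? xs) unique-ys)
      (λ (z∈xs , z∈new) → proj₂ (∈-filter⁻ (_∉? xs) {xs = ys} z∈new) (∈-deduplicate⁻ _≟_ xs z∈xs))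
    ⊆Z : deduplicate _≟_ (xs ++ ys) ⊆ Z
    ⊆Z {z} z∈ with ∈-++⁻ xs (∈-deduplicate⁻ _≟_ (xs ++ ys) z∈) | Any.any? (z ≟_) xs
    ... | inj₁ z∈xs | _       = ∈-++⁺ˡ (∈-deduplicate⁺ _≟_ z∈xs)
    ... | inj₂ _    | yes z∈xs = ∈-++⁺ˡ (∈-deduplicate⁺ _≟_ z∈xs)
    ... | inj₂ z∈ys | no z∉xs  = ∈-++⁺ʳ (deduplicate _≟_ xs) (∈-filter⁺ (_∉? xs) z∈ys z∉xs)
    Z⊆ : Z ⊆ deduplicate _≟_ (xs ++ ys)
    Z⊆ z∈ with ∈-++⁻ (deduplicate _≟_ xs) z∈
    ... | inj₁ z∈xs  = ∈-deduplicate⁺ _≟_ (∈-++⁺ˡ (∈-deduplicate⁻ _≟_ xs z∈xs))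
    ... | inj₂ z∈new = ∈-deduplicate⁺ _≟_ (∈-++⁺ʳ xs (proj₁ (∈-filter⁻ (_∉? xs) {xs = ys} z∈new)))
    same-length : distinct (xs ++ ys) ≡ length Z
    same-length = ≤-antisym (unique-length (deduplicate-! _≟_ (xs ++ ys)) ⊆Z) (unique-length unique-Z Z⊆)

length-filter-map : ∀ {B C : Set} {Q : Pred C 0ℓ} (Q? : Decidable Q) (f : B → C) (xs : List B) →
  length (filter Q? (map f xs)) ≡ length (filter (Q? ∘ f) xs)
length-filter-map Q? f [] = refl
length-filter-map Q? f (x ∷ xs) with Q? (f x)
... | yes _ = cong suc (length-filter-map Q? f xs)
... | no _  = length-filter-map Q? f xs

module _ {n : ℕ} where
  open DistinctCount (≡-dec (_≟F_ {n}) _≟ℕ_)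

  cubeParams : Cube n → List (Fin n × ℕ)
  cubeParams c = map (λ j → (j , label c j)) (allFin n)

  cubeParams-unique : (c : Cube n) → Unique (cubeParams c)
  cubeParams-unique c = UP.map⁺ (cong proj₁) (UP.allFin⁺ n)

  params-snoc : (acc : List (Cube n)) (c : Cube n) → params (acc ++ [ c ]) ≡ params acc ++ cubeParams c
  params-snoc acc c = trans (concatMap-++ cubeParams acc [ c ]) (cong (params acc ++_) (++-identityʳ (cubeParams c)))

  param-of : ∀ d {j v} → (j , v) ∈ cubeParams d → label d j ≡ v
  param-of d j∈ with ∈-map⁻ (λ i → (i , label d i)) j∈
  ... | i , _ , refl = refl

  fresh⇒new : ∀ acc c j → Fresh acc c j → (j , label c j) ∉ params acc
  fresh⇒new acc c j fresh j∈ =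
    All¬⇒¬Any (All.map (λ {d} ne j∈d → ne (param-of d j∈d)) (distinct-from fresh))
              (∈-concatMap⁻ cubeParams {xs = acc} j∈)

  new⇒fresh : ∀ acc c j → (j , label c j) ∉ params acc → Fresh acc c j
  new⇒fresh acc c j new = mk-fresh $ All.tabulate λ {d} d∈ same →
    new (∈-concatMap⁺ cubeParams {xs = acc} (Any.map (λ { refl → subst (λ v → (j , v) ∈ cubeParams d) same
                                                                    (∈-map⁺ (λ i → (i , label d i)) (∈-allFin j)) }) d∈))

  numParams-snoc : (acc : List (Cube n)) (c : Cube n) → numParams (acc ++ [ c ]) ≡ numParams acc + newParams acc c
  numParams-snoc acc c = begin
    distinct (params (acc ++ [ c ]))
      ≡⟨ cong distinct (params-snoc acc c) ⟩
    distinct (params acc ++ cubeParams c)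
      ≡⟨ distinct-++ (params acc) (cubeParams-unique c) ⟩
    distinct (params acc) + length (filter (_∉? params acc) (cubeParams c))
      ≡⟨ cong (distinct (params acc) +_) (begin
        length (filter (_∉? params acc) (cubeParams c))
          ≡⟨ length-filter-map (_∉? params acc) (λ j → (j , label c j)) (allFin n) ⟩
        length (filter (λ j → (j , label c j) ∉? params acc) (allFin n))
          ≡⟨ length-filter-tabulate (λ j → (j , label c j) ∉? params acc) id ⟩
        count (λ j → (j , label c j) ∉? params acc)
          ≡⟨ count-cong _ (fresh? acc c) (new⇒fresh acc c) (fresh⇒new acc c) ⟩
        count (fresh? acc c)
          ≡⟨ sym (newParams≡count acc c) ⟩
        newParams acc c ∎) ⟩
    numParams acc + newParams acc c ∎
    where open ≡-Reasoning

  numParams-↭ : ∀ {xs ys : List (Cube n)} → xs ↭ ys → numParams xs ≡ numParams ys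
  numParams-↭ xs↭ys = distinct-cong (params-⊆ xs↭ys) (params-⊆ (↭-sym xs↭ys))
    where
    params-⊆ : ∀ {xs ys : List (Cube n)} → xs ↭ ys → params xs ⊆ params ys
    params-⊆ {xs} {ys} xs↭ys = ∈-concatMap⁺ cubeParams {xs = ys} ∘ Any-resp-↭ xs↭ys ∘ ∈-concatMap⁻ cubeParams {xs = xs}

  newTotal : List (Cube n) → List (Cube n) → ℕ
  newTotal acc []      = 0
  newTotal acc (c ∷ r) = newParams acc c + newTotal (acc ++ [ c ]) r

  numParams-++ : (acc r : List (Cube n)) → numParams (acc ++ r) ≡ numParams acc + newTotal acc r
  numParams-++ acc []      = trans (cong numParams (++-identityʳ acc)) (sym (+-identityʳ _))
  numParams-++ acc (c ∷ r) = begin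
    numParams (acc ++ c ∷ r)                                     ≡⟨ cong numParams (sym (++-assoc acc [ c ] r)) ⟩
    numParams ((acc ++ [ c ]) ++ r)                              ≡⟨ numParams-++ (acc ++ [ c ]) r ⟩
    numParams (acc ++ [ c ]) + newTotal (acc ++ [ c ]) r         ≡⟨ cong (_+ newTotal (acc ++ [ c ]) r) (numParams-snoc acc c) ⟩
    numParams acc + newParams acc c + newTotal (acc ++ [ c ]) r  ≡⟨ +-assoc (numParams acc) _ _ ⟩
    numParams acc + newTotal acc (c ∷ r)                         ∎
    where open ≡-Reasoning

sumTo-cong : ∀ n {f g : ℕ → ℕ} → (∀ k → f k ≡ g k) → sumTo n f ≡ sumTo n g
sumTo-cong zero    f≡g = f≡g 0
sumTo-cong (suc n) f≡g = cong₂ _+_ (sumTo-cong n f≡g) (f≡g (suc n))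

sumTo-+ : ∀ n (f g : ℕ → ℕ) → sumTo n (λ k → f k + g k) ≡ sumTo n f + sumTo n g
sumTo-+ zero    f g = refl
sumTo-+ (suc n) f g = trans (cong (_+ (f (suc n) + g (suc n))) (sumTo-+ n f g))
                            (interchange +-commutativeSemigroup (sumTo n f) (sumTo n g) (f (suc n)) (g (suc n)))

sumTo-zero : ∀ n → sumTo n (λ k → k * 0) ≡ 0
sumTo-zero zero    = refl
sumTo-zero (suc n) = cong₂ _+_ (sumTo-zero n) (*-zeroʳ (suc n))

sumTo-mono : ∀ n {f g : ℕ → ℕ} → (∀ k → k ≤ n → f k ≤ g k) → sumTo n f ≤ sumTo n g
sumTo-mono zero    f≤g = f≤g 0 z≤n
sumTo-mono (suc n) f≤g = +-mono-≤ (sumTo-mono n (λ k k≤n → f≤g k (m≤n⇒m≤1+n k≤n))) (f≤g (suc n) ≤-refl)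

sumTo-strict : ∀ n {f g : ℕ → ℕ} → (∀ k → k ≤ n → f k ≤ g k) → ∀ k₀ → k₀ ≤ n → f k₀ < g k₀ →
  sumTo n f < sumTo n g
sumTo-strict zero    f≤g zero k₀≤n f<g = f<g
sumTo-strict (suc n) f≤g k₀ k₀≤n f<g with k₀ ≟ℕ suc n
... | yes refl = +-mono-≤-< (sumTo-mono n (λ k k≤n → f≤g k (m≤n⇒m≤1+n k≤n))) f<g
... | no k₀≢   = +-mono-<-≤ (sumTo-strict n (λ k k≤n → f≤g k (m≤n⇒m≤1+n k≤n)) k₀ (≤-pred (≤∧≢⇒< k₀≤n k₀≢)) f<g)
                            (f≤g (suc n) ≤-refl)

sumTo-weighted-hit : ∀ n v → v ≤ n → sumTo n (λ k → k * hit v k) ≡ v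
sumTo-weighted-hit zero    zero    _   = refl
sumTo-weighted-hit (suc n) v       v≤n with v ≟ℕ suc n
... | yes refl = cong₂ _+_ (below n ≤-refl) (*-identityʳ (suc n))
  where
  below : ∀ m → m < suc n → sumTo m (λ k → k * hit (suc n) k) ≡ 0
  below zero    _   = refl
  below (suc m) m<n = cong₂ _+_ (below m (≤-trans (n≤1+n _) m<n))
                                (trans (cong (suc m *_) (hit-other _ _ (>⇒≢ m<n))) (*-zeroʳ (suc m)))
... | no v≢    = trans (cong₂ _+_ (sumTo-weighted-hit n v (≤-pred (≤∧≢⇒< v≤n v≢))) (*-zeroʳ (suc n)))
                       (+-identityʳ v)

triangle : ∀ n → n * (n + 1) / 2 ≡ sumTo n (λ k → k)
triangle n = trans (cong (_/ 2) (sym (double n))) (m*n/n≡m (sumTo n (λ k → k)) 2)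
  where
  double : ∀ n → sumTo n (λ k → k) * 2 ≡ n * (n + 1)
  double zero    = refl
  double (suc n) = begin
    (sumTo n (λ k → k) + suc n) * 2      ≡⟨ *-distribʳ-+ 2 (sumTo n (λ k → k)) (suc n) ⟩
    sumTo n (λ k → k) * 2 + suc n * 2    ≡⟨ cong (_+ suc n * 2) (double n) ⟩
    n * (n + 1) + suc n * 2              ≡⟨ step n ⟩
    suc n * (suc n + 1)                  ∎
    where
    open ≡-Reasoning
    step : ∀ n → n * (n + 1) + suc n * 2 ≡ suc n * (suc n + 1)
    step = solve-∀

weighted-counts : ∀ {n} (acc r : List (Cube n)) → sumTo n (λ k → k * NkGo k acc r) ≡ newTotal acc r
weighted-counts {n} acc []      = sumTo-zero n
weighted-counts {n} acc (c ∷ r) = begin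
  sumTo n (λ k → k * (hit v k + NkGo k (acc ++ [ c ]) r))
    ≡⟨ sumTo-cong n (λ k → *-distribˡ-+ k (hit v k) _) ⟩
  sumTo n (λ k → k * hit v k + k * NkGo k (acc ++ [ c ]) r)
    ≡⟨ sumTo-+ n _ _ ⟩
  sumTo n (λ k → k * hit v k) + sumTo n (λ k → k * NkGo k (acc ++ [ c ]) r)
    ≡⟨ cong₂ _+_ (sumTo-weighted-hit n v (newParams-≤ acc c)) (weighted-counts (acc ++ [ c ]) r) ⟩
  v + newTotal (acc ++ [ c ]) r ∎
  where
  open ≡-Reasoning
  v : ℕ
  v = newParams acc c

weight-≥ : ∀ {n} (N : ℕ → ℕ) → (∀ k → k ≤ n → 1 ≤ N k) → ∀ k → k ≤ n → k ≤ k * N k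
weight-≥ N positive k k≤n = subst (_≤ k * N k) (*-identityʳ k) (*-monoʳ-≤ k (positive k k≤n))

weighted-sum-bound : ∀ n (N : ℕ → ℕ) → (∀ k → k ≤ n → 1 ≤ N k) → n * (n + 1) / 2 ≤ sumTo n (λ k → k * N k)
weighted-sum-bound n N positive =
  subst (_≤ sumTo n (λ k → k * N k)) (sym (triangle n)) (sumTo-mono n (weight-≥ N positive))

weighted-sum-tight : ∀ n (N : ℕ → ℕ) → (∀ k → k ≤ n → 1 ≤ N k) →
  sumTo n (λ k → k * N k) ≡ n * (n + 1) / 2 → ∀ k → 1 ≤ k → k ≤ n → N k ≡ 1
weighted-sum-tight n N positive tight k 1≤k k≤n with N k ≤? 1
... | yes N≤1 = ≤-antisym N≤1 (positive k k≤n)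
... | no N≰1  = contradiction (trans (sym (triangle n)) (sym tight))
                  (<⇒≢ (sumTo-strict n (weight-≥ N positive) k k≤n k<k*N))
  where
  k<k*N : k < k * N k
  k<k*N = <-≤-trans (subst (k <_) (sym (trans (*-suc k 1) (cong (k +_) (*-identityʳ k)))) (m<m+n k 1≤k))
                    (*-monoʳ-≤ k (≰⇒> N≰1))

all-values-occur : ∀ {n} (p : List (Cube n)) → Walk [] p → Saturated p → ∀ k → k ≤ n → 1 ≤ Nk k p
all-values-occur []      _ sat _ _   = contradiction [] (sat (freshCube []))
all-values-occur (C ∷ r) w sat k k≤n = NkGo-positive k w sat (subst (k ≤_) (sym (newParams-[] C)) k≤n)

parameter-count : ∀ {n} {cp p : List (Cube n)} → p ↭ cp → numParams cp ≡ sumTo n (λ k → k * Nk k p)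
parameter-count {p = p} p↭cp = trans (sym (numParams-↭ p↭cp)) (trans (numParams-++ [] p) (sym (weighted-counts [] p)))

packing-↭ : ∀ {n} {xs ys : List (Cube n)} → xs ↭ ys → IsPacking xs → IsPacking ys
packing-↭ {n} xs↭ys = PermProps.AllPairs-resp-↭ (setoid (Cube n)) nonOverlap-sym (resp₂ NonOverlap) (↭⇒↭ₛ xs↭ys)

laminated-↭ : ∀ {n} {xs ys : List (Cube n)} → xs ↭ ys → Laminated xs → Laminated ys
laminated-↭ xs↭ys (j , t , all) = j , t , All-resp-↭ xs↭ys all

proposition11 : (n : ℕ) (cp p : List (Cube n)) →
    IsPacking cp → NonExtensible cp → p ↭ cp → PositivePath p →
    ((Nk n p ≡ 1) × (Nk (n ∸ 1) p ≡ 1))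
    × ((Nk (n ∸ 2) p ≤ 2) × ((Nk (n ∸ 2) p ≡ 2) ⇔ Laminated cp))
    × (∀ k → k ≤ n → 1 ≤ Nk k p)
    × ((numParams cp ≡ sumTo n (λ k → k * Nk k p)) × (n * (n + 1) / 2 ≤ numParams cp))
    × (numParams cp ≡ n * (n + 1) / 2 → ∀ k → 1 ≤ k → k ≤ n → Nk k p ≡ 1)
proposition11 n cp p packing (few , unextendable) p↭cp positive =
  let (top , N₂-bound , lamination) = top-counts n p walk saturated (subst (_< 2 ^ n) (sym (↭-length p↭cp)) few)
  in top ,
     (N₂-bound , mk⇔ (laminated-↭ p↭cp ∘ to lamination) (from lamination ∘ laminated-↭ (↭-sym p↭cp))) ,
     every-value ,
     (count-formula , subst (n * (n + 1) / 2 ≤_) (sym count-formula) (weighted-sum-bound n N every-value)) ,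
     λ tight → weighted-sum-tight n N every-value (trans (sym count-formula) tight)
  where
  N : ℕ → ℕ
  N k = Nk k p
  walk : Walk [] p
  walk = positive-walk [] p (packing-↭ (↭-sym p↭cp) packing) positive
  saturated : Saturated p
  saturated d adm = unextendable d (All-resp-↭ p↭cp (All.map nonOverlap adm))
  every-value : ∀ k → k ≤ n → 1 ≤ N k
  every-value = all-values-occur p walk saturated
  count-formula : numParams cp ≡ sumTo n (λ k → k * N k)
  count-formula = parameter-count p↭cp
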